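{- For every formula $A$: if there exists a closed proof table for $\{\mathbf{F_l}A\}$ in the calculus $\mathbf{D_1}$, then $A$ is valid in Dummett logic, i.e. $\rho\Vdash A$ for every linearly ordered Kripke model $\langle P,\leq,\rho,\Vdash\rangle$.
   Context: Formulas are built from propositional variables and $\top,\bot$ using $\land,\lor,\to$. A model is $\langle P,\leq,\rho,\Vdash\rangle$ with $\langle P,\leq\rangle$ a linear order with minimum $\rho$, forcing on atoms upward persistent, $\top$ always and $\bot$ never forced, extended as usual ($\alpha\Vdash A\to B$ iff for all $\beta\geq\alpha$, $\beta\Vdash A$ implies $\beta\Vdash B$). Signed formulas use signs $\mathbf{T},\mathbf{F},\mathbf{F_l},\mathbf{F_n},\mathbf{T_n},\widehat{\mathbf{T}},\widetilde{\mathbf{T}}$ (realizability: $\mathbf{T}A$: $\alpha\Vdash A$; $\mathbf{F}A$: $\alpha\not\Vdash A$; $\mathbf{F_n}A$: some $\beta>\alpha$ with $\beta\not\Vdash A$; $\mathbf{T_n}A$: all $\beta>\alpha$ force $A$; $\mathbf{F_l}A$: $\mathbf{F}A$ and $\mathbf{T_n}A$; $\widetilde{\mathbf{T}}(B\to C)$: $\alpha\Vdash B\to C$ and $\mathbf{F_n}B$; $\widehat{\mathbf{T}}(B\to C)$: $\alpha\Vdash B\to C$ and $\alpha\not\Vdash B$). Rules of $\mathbf{D_1}$ (premise / conclusions, $S$ a set of signed formulas, the displayed formulas of a premise not belonging to $S$): ($\mathbf{T}\land$) $S,\mathbf{T}(A\land B)$ / $S,\mathbf{T}A,\mathbf{T}B$;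 ($\mathbf{F_l}\land$) $S,\mathbf{F_l}(A\land B)$ / $S,\mathbf{F_l}A,\mathbf{T_n}B\mid S,\mathbf{T}A,\mathbf{F_l}B$; ($\mathbf{T}\lor$) $S,\mathbf{T}(A\lor B)$ / $S,\mathbf{T}A\mid S,\mathbf{T}B$; ($\mathbf{F_l}\lor$) $S,\mathbf{F_l}(A\lor B)$ / $S,\mathbf{F}A,\mathbf{F_l}B\mid S,\mathbf{F}B,\mathbf{F_l}A$; ($\mathbf{T}\to$) $S,\mathbf{T}(A\to B)$ / $S,\mathbf{T}B\mid S,\mathbf{F_l}A,\mathbf{T_n}B\mid S,\widetilde{\mathbf{T}}(A\to B)$; ($\mathbf{F_l}\to$) $S,\mathbf{F_l}(A\to B)$ / $S,\mathbf{T}A,\mathbf{F_l}B$; ($\mathbf{F}$-decide) $S,\mathbf{F}A$ / $S,\mathbf{F_l}A\mid S,\mathbf{F_n}A$; ($\widehat{\mathbf{T}}$-decide) $S,\widehat{\mathbf{T}}(A\to B)$ / $S,\mathbf{F_l}A,\mathbf{T_n}B\mid S,\widetilde{\mathbf{T}}(A\to B)$; ($\mathbf{F_n}\widetilde{\mathbf{T}}$) $S,\widetilde{\mathbf{T}}(A_1\to B_1),\dots,\widetilde{\mathbf{T}}(A_n\to B_n),\mathbf{F_n}C_{n+1},\dots,\mathbf{F_n}C_u$ / $S_c,V_1,S_{\mathbf F}\mid\dots\mid S_c,V_n,S_{\mathbf F}\mid S_c,S_{\widehat{\mathbf T}},V_{n+1}\mid\dots\mid S_c,S_{\widehat{\mathbf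 T}},V_u$, with $S_{\mathbf F}=\{\mathbf{F}C_{n+1},\dots,\mathbf{F}C_u\}$, $S_{\widehat{\mathbf T}}=\{\widehat{\mathbf{T}}(A_i\to B_i):1\le i\le n\}$, $V_j=\{\widehat{\mathbf{T}}(A_i\to B_i):i\ne j,i\le n\}\cup\{\mathbf{F_l}A_j,\mathbf{T_n}B_j\}$ for $j\le n$, $V_j=\{\mathbf{F}C_i:i\ne j,n<i\le u\}\cup\{\mathbf{F_l}C_j\}$ for $n<j\le u$, and $S_c=\{\mathbf{T}A:\mathbf{T}A\in S\}\cup\{\mathbf{T}A:\mathbf{F_l}A\in S\}\cup\{\mathbf{T}A:\mathbf{T_n}A\in S\}$. A set is inconsistent if it contains $\mathbf{T}\bot$, or both $\mathbf{T}A$ and $\mathbf{F}A$, or both $\mathbf{T}A$ and $\mathbf{F_l}A$. A proof table for a set $S$ is a tree rooted at $S$ obtained by successive applications of the rules; it is closed if all its leaves are inconsistent sets. -}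

module Defs where

open import Data.Nat using (ℕ; _≤_; _+_)
open import Data.Fin using (Fin)
open import Data.Product using (_×_; _,_; proj₁; proj₂)
open import Data.Sum using (_⊎_)
open import Data.Unit using (⊤)
open import Data.Empty using (⊥)
open import Data.List using (List; []; _∷_; _++_; map; length; lookup; removeAt; concatMap)
open import Data.List.Membership.Propositional using (_∈_; _∉_)
open import Data.List.Relation.Unary.All using (All)
open import Data.List.Relation.Unary.Unique.Propositional using (Unique)
open import Relation.Binary.PropositionalEquality using (_≡_)
open import Relation.Binary.Structures using (IsTotalOrder)

infixr 6 _∧̇_
infixr 5 _∨̇_
infixr 4 _⇒_

data Formula : Set where
  var  : ℕ → Formula
  ⊤̇ ⊥̇ : Formula
  _∧̇_ _∨̇_ _⇒_ : Formula → Formula → Formula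

record Model : Set₁ where
  field
    World       : Set
    _≼_         : World → World → Set
    isTotal     : IsTotalOrder _≡_ _≼_
    ρ           : World
    ρ-min       : ∀ α → ρ ≼ α
    _⊩at_       : World → ℕ → Set
    persistent  : ∀ {α β} p → α ≼ β → α ⊩at p → β ⊩at p

open Model public

_⊩[_]_ : (M : Model) → World M → Formula → Set
M ⊩[ α ] var p   = _⊩at_ M α p
M ⊩[ α ] ⊤̇       = ⊤
M ⊩[ α ] ⊥̇       = ⊥
M ⊩[ α ] (A ∧̇ B) = (M ⊩[ α ] A) × (M ⊩[ α ] B)
M ⊩[ α ] (A ∨̇ B) = (M ⊩[ α ] A) ⊎ (M ⊩[ α ] B)
M ⊩[ α ] (A ⇒ B) = ∀ β → _≼_ M α β → M ⊩[ β ] A → M ⊩[ β ] B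

Valid : Formula → Set₁
Valid A = (M : Model) → M ⊩[ ρ M ] A

-- Signed formulas
-- Signs: T, F, F_l, F_n, T_n, T̂ (Th), T̃ (Tt)

data Sign : Set where
  T F Fl Fn Tn Th Tt : Sign

infix 3 _∙_
data SF : Set where
  _∙_ : Sign → Formula → SF

-- finite sets of signed formulas are represented by lists, compared up to
-- having the same elements
_≋_ : List SF → List SF → Set
Γ ≋ Δ = ∀ x → (x ∈ Γ → x ∈ Δ) × (x ∈ Δ → x ∈ Γ)

data Inconsistent (Γ : List SF) : Set where
  has⊥  : (T ∙ ⊥̇) ∈ Γ → Inconsistent Γ
  T-F   : ∀ {A} → (T ∙ A) ∈ Γ → (F ∙ A) ∈ Γ → Inconsistent Γ
  T-Fl  : ∀ {A} → (T ∙ A) ∈ Γ → (Fl ∙ A) ∈ Γ → Inconsistent Γ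

scOne : SF → List SF
scOne (T ∙ A)  = (T ∙ A) ∷ []
scOne (Fl ∙ A) = (T ∙ A) ∷ []
scOne (Tn ∙ A) = (T ∙ A) ∷ []
scOne (_ ∙ _)  = []

Sc : List SF → List SF
Sc S = concatMap scOne S

tildeOf : Formula × Formula → SF
tildeOf (A , B) = Tt ∙ (A ⇒ B)

hatOf : Formula × Formula → SF
hatOf (A , B) = Th ∙ (A ⇒ B)

Vimp : (as : List (Formula × Formula)) → Fin (length as) → List SF
Vimp as j = map hatOf (removeAt as j)
            ++ (Fl ∙ proj₁ (lookup as j)) ∷ (Tn ∙ proj₂ (lookup as j)) ∷ []

Vneg : (cs : List Formula) → Fin (length cs) → List SF
Vneg cs j = map (F ∙_) (removeAt cs j) ++ (Fl ∙ lookup cs j) ∷ []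

-- Existence of a closed proof table of D₁ for a set Γ.
-- A premise "S, H₁, …, H_k" is any set Γ equal (as a set) to H₁,…,H_k ∪ S
-- with the displayed formulas H_i not belonging to S.

data Closed : List SF → Set where
  leaf : ∀ {Γ} → Inconsistent Γ → Closed Γ
  T∧ : ∀ {Γ S A B} → Γ ≋ ((T ∙ A ∧̇ B) ∷ S) → (T ∙ A ∧̇ B) ∉ S →
       Closed ((T ∙ A) ∷ (T ∙ B) ∷ S) → Closed Γ
  Fl∧ : ∀ {Γ S A B} → Γ ≋ ((Fl ∙ A ∧̇ B) ∷ S) → (Fl ∙ A ∧̇ B) ∉ S →
       Closed ((Fl ∙ A) ∷ (Tn ∙ B) ∷ S) →
       Closed ((T ∙ A) ∷ (Fl ∙ B) ∷ S) → Closed Γ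
  T∨ : ∀ {Γ S A B} → Γ ≋ ((T ∙ A ∨̇ B) ∷ S) → (T ∙ A ∨̇ B) ∉ S →
       Closed ((T ∙ A) ∷ S) → Closed ((T ∙ B) ∷ S) → Closed Γ
  Fl∨ : ∀ {Γ S A B} → Γ ≋ ((Fl ∙ A ∨̇ B) ∷ S) → (Fl ∙ A ∨̇ B) ∉ S →
       Closed ((F ∙ A) ∷ (Fl ∙ B) ∷ S) →
       Closed ((F ∙ B) ∷ (Fl ∙ A) ∷ S) → Closed Γ
  T⇒ : ∀ {Γ S A B} → Γ ≋ ((T ∙ A ⇒ B) ∷ S) → (T ∙ A ⇒ B) ∉ S →
       Closed ((T ∙ B) ∷ S) →
       Closed ((Fl ∙ A) ∷ (Tn ∙ B) ∷ S) →
       Closed ((Tt ∙ A ⇒ B) ∷ S) → Closed Γ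
  Fl⇒ : ∀ {Γ S A B} → Γ ≋ ((Fl ∙ A ⇒ B) ∷ S) → (Fl ∙ A ⇒ B) ∉ S →
       Closed ((T ∙ A) ∷ (Fl ∙ B) ∷ S) → Closed Γ
  F-decide : ∀ {Γ S A} → Γ ≋ ((F ∙ A) ∷ S) → (F ∙ A) ∉ S →
       Closed ((Fl ∙ A) ∷ S) → Closed ((Fn ∙ A) ∷ S) → Closed Γ
  Th-decide : ∀ {Γ S A B} → Γ ≋ ((Th ∙ A ⇒ B) ∷ S) → (Th ∙ A ⇒ B) ∉ S →
       Closed ((Fl ∙ A) ∷ (Tn ∙ B) ∷ S) →
       Closed ((Tt ∙ A ⇒ B) ∷ S) → Closed Γ
  -- (F_n T̃): as = [(A₁,B₁),…,(A_n,B_n)], cs = [C_{n+1},…,C_u], u ≥ 1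
  FnTt : ∀ {Γ S} (as : List (Formula × Formula)) (cs : List Formula) →
       1 ≤ length as + length cs →
       Γ ≋ ((map tildeOf as ++ map (Fn ∙_) cs) ++ S) →
       Unique (map tildeOf as ++ map (Fn ∙_) cs) →
       All (_∉ S) (map tildeOf as ++ map (Fn ∙_) cs) →
       (∀ (j : Fin (length as)) → Closed (Sc S ++ Vimp as j ++ map (F ∙_) cs)) →
       (∀ (j : Fin (length cs)) → Closed (Sc S ++ map hatOf as ++ Vneg cs j)) →
       Closed Γ

-- Every rule of D₁ preserves realizability of a set of signed formulas: for
-- all rules but (F_n T̃) the same world of the same model realizes one of the
-- conclusions, by a case analysis that uses linearity. For (F_n T̃), among the
-- formulas A_i, C_j refuted after α take the one K that becomes true last,
-- and insert a new world just below the first world forcing K. It refutes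
-- every A_i and C_j, still satisfies the implications and every formula true
-- at α or after α, and its successors are exactly the worlds forcing K; so
-- it realizes the conclusion belonging to K. Hence closed tables are not
-- realizable. If ρ ⊮ A, the same insertion with K = A gives a world
-- realizing F_l A, so a closed table for F_l A forces ρ ⊩ A.
module Submission where

open import Defs
open import Level using (0ℓ)
open import Axiom.ExcludedMiddle using (ExcludedMiddle)
open import Data.Nat using (_≤_; _+_; z≤n; s≤s)
open import Data.Fin using (Fin; zero; suc)
open import Data.Product as Product using (∃; ∃₂; _×_; _,_; proj₁; proj₂)
open import Data.Sum as Sum using (_⊎_; inj₁; inj₂)
open import Data.Unit using (tt)
open import Data.Empty using (⊥; ⊥-elim)
open import Data.List using (List; []; _∷_; _++_; map; length; lookup; removeAt)
open import Data.List.Properties using (length-++; length-map)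
open import Data.List.Membership.Propositional using (_∈_)
open import Data.List.Membership.Propositional.Properties
  using (∈-map⁺; ∈-map⁻; ∈-++⁺ˡ; ∈-++⁺ʳ; ∈-++⁻)
open import Data.List.Relation.Binary.Subset.Propositional using (_⊆_)
open import Data.List.Relation.Unary.All as All using (All; []; _∷_)
open import Data.List.Relation.Unary.All.Properties using (anti-mono; map⁺; map⁻; ++⁺; ++⁻)
open import Data.List.Relation.Unary.Any using (here; there; index)
open import Data.List.Relation.Unary.Any.Properties using (lookup-index)
open import Relation.Nullary using (¬_; yes; no)
open import Relation.Nullary.Decidable using (decidable-stable)
open import Relation.Binary.PropositionalEquality
  using (_≡_; refl; sym; trans; cong; subst; isEquivalence)
open import Relation.Binary.Structures using (IsTotalOrder)

module _ (M : Model) where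
  private module ≼ = IsTotalOrder (isTotal M)

  _≺_ : World M → World M → Set
  α ≺ β = ¬ _≼_ M β α

  ≺⇒≼ : ∀ {α β} → α ≺ β → _≼_ M α β
  ≺⇒≼ {α} {β} α≺β with ≼.total α β
  ... | inj₁ α≼β = α≼β
  ... | inj₂ β≼α = ⊥-elim (α≺β β≼α)

  ⊩-mono : ∀ A {α β} → _≼_ M α β → M ⊩[ α ] A → M ⊩[ β ] A
  ⊩-mono (var p)   α≼β a       = persistent M p α≼β a
  ⊩-mono ⊤̇         α≼β _       = tt
  ⊩-mono ⊥̇         α≼β ()
  ⊩-mono (A ∧̇ B)   α≼β (a , b) = ⊩-mono A α≼β a , ⊩-mono B α≼β b
  ⊩-mono (A ∨̇ B)   α≼β a∨b     = Sum.map (⊩-mono A α≼β) (⊩-mono B α≼β) a∨b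
  ⊩-mono (A ⇒ B)   α≼β a⇒b     = λ γ β≼γ → a⇒b γ (≼.trans α≼β β≼γ)

  ∉upset⇒≼ : (U : World M → Set) → (∀ {x y} → _≼_ M x y → U x → U y) →
             ∀ {x y} → ¬ U x → U y → _≼_ M x y
  ∉upset⇒≼ U U-up {x} {y} ¬Ux Uy with ≼.total x y
  ... | inj₁ x≼y = x≼y
  ... | inj₂ y≼x = ⊥-elim (¬Ux (U-up y≼x Uy))

  ForcedAfter : World M → Formula → Set
  ForcedAfter α A = ∀ β → α ≺ β → M ⊩[ β ] A

  RefutedAfter : World M → Formula → Set
  RefutedAfter α A = ∃ λ β → α ≺ β × ¬ M ⊩[ β ] A

  refutedAfter⇒refuted : ∀ {α} A → RefutedAfter α A → ¬ M ⊩[ α ] A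
  refutedAfter⇒refuted A (β , α≺β , β⊮A) a = β⊮A (⊩-mono A (≺⇒≼ α≺β) a)

  ⇒-forcedAfter : ∀ {α A B} → M ⊩[ α ] (A ⇒ B) → ForcedAfter α A → ForcedAfter α B
  ⇒-forcedAfter a⇒b after-a β α≺β = a⇒b β (≺⇒≼ α≺β) (after-a β α≺β)

_⊨[_]_ : (M : Model) → World M → SF → Set
M ⊨[ α ] (T ∙ A)        = M ⊩[ α ] A
M ⊨[ α ] (F ∙ A)        = ¬ M ⊩[ α ] A
M ⊨[ α ] (Fl ∙ A)       = ¬ M ⊩[ α ] A × ForcedAfter M α A
M ⊨[ α ] (Fn ∙ A)       = RefutedAfter M α A
M ⊨[ α ] (Tn ∙ A)       = ForcedAfter M α A
M ⊨[ α ] (Th ∙ (A ⇒ B)) = M ⊩[ α ] (A ⇒ B) × ¬ M ⊩[ α ] A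
M ⊨[ α ] (Tt ∙ (A ⇒ B)) = M ⊩[ α ] (A ⇒ B) × RefutedAfter M α A
-- T̂ and T̃ are only meaningful on implications; elsewhere they are unrealizable.
M ⊨[ α ] (Th ∙ _)       = ⊥
M ⊨[ α ] (Tt ∙ _)       = ⊥

_⊨[_]*_ : (M : Model) → World M → List SF → Set
M ⊨[ α ]* Γ = All (M ⊨[ α ]_) Γ

Realizable : List SF → Set₁
Realizable Γ = ∃₂ λ (M : Model) (α : World M) → M ⊨[ α ]* Γ

inconsistent⇒unrealizable : ∀ {M α Γ} → Inconsistent Γ → ¬ M ⊨[ α ]* Γ
inconsistent⇒unrealizable (has⊥ ⊥∈)     R = All.lookup R ⊥∈
inconsistent⇒unrealizable (T-F A∈ ¬A∈)  R = All.lookup R ¬A∈ (All.lookup R A∈)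
inconsistent⇒unrealizable (T-Fl A∈ ¬A∈) R = proj₁ (All.lookup R ¬A∈) (All.lookup R A∈)

All-uncons-≋ : ∀ {P : SF → Set} {Γ x S} → Γ ≋ (x ∷ S) → All P Γ → P x × All P S
All-uncons-≋ Γ≋xS R with anti-mono (λ {y} → proj₂ (Γ≋xS y)) R
... | r ∷ rs = r , rs

⊨-Sc : ∀ {M M′ α w} →
       (∀ A → M ⊩[ α ] A → M′ ⊩[ w ] A) → (∀ A → ForcedAfter M α A → M′ ⊩[ w ] A) →
       ∀ {S} → M ⊨[ α ]* S → M′ ⊨[ w ]* Sc S
⊨-Sc now after {[]}             []       = []
⊨-Sc now after {(T ∙ A) ∷ S}    (r ∷ rs) = now A r ∷ ⊨-Sc now after rs
⊨-Sc now after {(Fl ∙ A) ∷ S}   (r ∷ rs) = after A (proj₂ r) ∷ ⊨-Sc now after rs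
⊨-Sc now after {(Tn ∙ A) ∷ S}   (r ∷ rs) = after A r ∷ ⊨-Sc now after rs
⊨-Sc now after {(F ∙ A) ∷ S}    (_ ∷ rs) = ⊨-Sc now after rs
⊨-Sc now after {(Fn ∙ A) ∷ S}   (_ ∷ rs) = ⊨-Sc now after rs
⊨-Sc now after {(Th ∙ A) ∷ S}   (_ ∷ rs) = ⊨-Sc now after rs
⊨-Sc now after {(Tt ∙ A) ∷ S}   (_ ∷ rs) = ⊨-Sc now after rs

removeAt-⊆ : ∀ {A : Set} (xs : List A) (j : Fin (length xs)) → removeAt xs j ⊆ xs
removeAt-⊆ (x ∷ xs) zero    x∈         = there x∈
removeAt-⊆ (x ∷ xs) (suc j) (here x≡)  = here x≡
removeAt-⊆ (x ∷ xs) (suc j) (there x∈) = there (removeAt-⊆ xs j x∈)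

module Classical (em : ExcludedMiddle 0ℓ) where

  module _ (M : Model) where
    private module ≼ = IsTotalOrder (isTotal M)

    forcedAfter⊎refutedAfter : ∀ α A → ForcedAfter M α A ⊎ RefutedAfter M α A
    forcedAfter⊎refutedAfter α A with em {RefutedAfter M α A}
    ... | yes refuted = inj₂ refuted
    ... | no ¬refuted =
      inj₁ λ β α≺β → decidable-stable em λ β⊮A → ¬refuted (β , α≺β , β⊮A)

    ⊩-comparable : ∀ A B → (∀ {β} → M ⊩[ β ] A → M ⊩[ β ] B) ⊎ (∀ {β} → M ⊩[ β ] B → M ⊩[ β ] A)
    ⊩-comparable A B with em {∃ λ γ → M ⊩[ γ ] A × ¬ M ⊩[ γ ] B}
    ... | no ¬γ = inj₁ λ {β} a → decidable-stable em λ β⊮B → ¬γ (β , a , β⊮B)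
    ... | yes (γ , γ⊩A , γ⊮B) = inj₂ B⊆A
      where
      B⊆A : ∀ {β} → M ⊩[ β ] B → M ⊩[ β ] A
      B⊆A {β} b with ≼.total β γ
      ... | inj₁ β≼γ = ⊥-elim (γ⊮B (⊩-mono M B β≼γ b))
      ... | inj₂ γ≼β = ⊩-mono M A γ≼β γ⊩A

    latest : ∀ Ds → 1 ≤ length Ds →
             ∃ λ K → K ∈ Ds × (∀ {β D} → D ∈ Ds → M ⊩[ β ] D → M ⊩[ β ] K)
    latest (D ∷ [])       _ = D , here refl , λ { (here refl) d → d }
    latest (D ∷ E ∷ Ds)   _ with latest (E ∷ Ds) (s≤s z≤n)
    ... | K , K∈ , K-latest with ⊩-comparable D K
    ... | inj₁ D⊆K = K , there K∈ , λ { (here refl) d → D⊆K d ; (there D∈) d → K-latest D∈ d }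
    ... | inj₂ K⊆D = D , here refl , λ { (here refl) d → d ; (there D∈) d → K⊆D (K-latest D∈ d) }

  module _ (M : Model) {α : World M} where
    private module ≼ = IsTotalOrder (isTotal M)

    Fl∧-inversion : ∀ A B → M ⊨[ α ] (Fl ∙ A ∧̇ B) →
                    (M ⊨[ α ] (Fl ∙ A) × M ⊨[ α ] (Tn ∙ B)) ⊎ (M ⊨[ α ] (T ∙ A) × M ⊨[ α ] (Fl ∙ B))
    Fl∧-inversion A B (α⊮A∧B , after) with em {M ⊩[ α ] A}
    ... | yes a = inj₂ (a , (λ b → α⊮A∧B (a , b)) , λ β α≺β → proj₂ (after β α≺β))
    ... | no α⊮A = inj₁ ((α⊮A , λ β α≺β → proj₁ (after β α≺β)) , λ β α≺β → proj₂ (after β α≺β))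

    Fl∨-inversion : ∀ A B → M ⊨[ α ] (Fl ∙ A ∨̇ B) →
                    (M ⊨[ α ] (F ∙ A) × M ⊨[ α ] (Fl ∙ B)) ⊎ (M ⊨[ α ] (F ∙ B) × M ⊨[ α ] (Fl ∙ A))
    Fl∨-inversion A B (α⊮A∨B , after) with forcedAfter⊎refutedAfter M α B
    ... | inj₁ after-b = inj₁ ((λ a → α⊮A∨B (inj₁ a)) , (λ b → α⊮A∨B (inj₂ b)) , after-b)
    ... | inj₂ (γ , α≺γ , γ⊮B) = inj₂ ((λ b → α⊮A∨B (inj₂ b)) , (λ a → α⊮A∨B (inj₁ a)) , after-a)
      where
      -- A holds after α: below γ because B fails there, above γ by persistence.
      after-a : ForcedAfter M α A
      after-a β α≺β with ≼.total β γ
      after-a β α≺β | inj₁ β≼γ with after β α≺β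
      ... | inj₁ a = a
      ... | inj₂ b = ⊥-elim (γ⊮B (⊩-mono M B β≼γ b))
      after-a β α≺β | inj₂ γ≼β with after γ α≺γ
      ... | inj₁ a = ⊩-mono M A γ≼β a
      ... | inj₂ b = ⊥-elim (γ⊮B b)

    T⇒-inversion : ∀ A B → M ⊨[ α ] (T ∙ A ⇒ B) →
                   M ⊨[ α ] (T ∙ B) ⊎ (M ⊨[ α ] (Fl ∙ A) × M ⊨[ α ] (Tn ∙ B)) ⊎ M ⊨[ α ] (Tt ∙ A ⇒ B)
    T⇒-inversion A B a⇒b with em {M ⊩[ α ] B} | forcedAfter⊎refutedAfter M α A
    ... | yes b   | _               = inj₁ b
    ... | no α⊮B  | inj₂ refuted-a  = inj₂ (inj₂ (a⇒b , refuted-a))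
    ... | no α⊮B  | inj₁ after-a    =
      inj₂ (inj₁ (((λ a → α⊮B (a⇒b α ≼.refl a)) , after-a) ,
                  ⇒-forcedAfter M {A = A} {B = B} a⇒b after-a))

    Fl⇒-inversion : ∀ A B → M ⊨[ α ] (Fl ∙ A ⇒ B) → M ⊨[ α ] (T ∙ A) × M ⊨[ α ] (Fl ∙ B)
    Fl⇒-inversion A B (α⊮A⇒B , after) with em {M ⊩[ α ] A}
    ... | yes a = a , (λ b → α⊮A⇒B λ β α≼β _ → ⊩-mono M B α≼β b) ,
                  λ β α≺β → after β α≺β β ≼.refl (⊩-mono M A (≺⇒≼ M α≺β) a)
    -- Without A at α, every world forcing A is strictly after α, where A ⇒ B holds.
    ... | no α⊮A = ⊥-elim (α⊮A⇒B λ β α≼β a →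
                    after β (λ β≼α → α⊮A (⊩-mono M A β≼α a)) β ≼.refl a)

    F-inversion : ∀ A → M ⊨[ α ] (F ∙ A) → M ⊨[ α ] (Fl ∙ A) ⊎ M ⊨[ α ] (Fn ∙ A)
    F-inversion A α⊮A = Sum.map₁ (α⊮A ,_) (forcedAfter⊎refutedAfter M α A)

    Th-inversion : ∀ A B → M ⊨[ α ] (Th ∙ A ⇒ B) →
                   (M ⊨[ α ] (Fl ∙ A) × M ⊨[ α ] (Tn ∙ B)) ⊎ M ⊨[ α ] (Tt ∙ A ⇒ B)
    Th-inversion A B (a⇒b , α⊮A) with forcedAfter⊎refutedAfter M α A
    ... | inj₁ after-a   = inj₁ ((α⊮A , after-a) , ⇒-forcedAfter M {A = A} {B = B} a⇒b after-a)
    ... | inj₂ refuted-a = inj₂ (a⇒b , refuted-a)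

  -- Insert a new world between the worlds outside the upset U and those in U.
  module Insertion (M : Model) (U : World M → Set)
                   (U-up : ∀ {x y} → _≼_ M x y → U x → U y) (ρ∉U : ¬ U (ρ M)) where
    private module ≼ = IsTotalOrder (isTotal M)

    data Point : Set where
      old : World M → Point
      new : Point

    data _⊑_ : Point → Point → Set where
      old⊑old : ∀ {x y} → _≼_ M x y → old x ⊑ old y
      old⊑new : ∀ {x} → ¬ U x → old x ⊑ new
      new⊑old : ∀ {y} → U y → new ⊑ old y
      new⊑new : new ⊑ new

    private
      ∉U⇒≼ : ∀ {x y} → ¬ U x → U y → _≼_ M x y
      ∉U⇒≼ = ∉upset⇒≼ M U U-up

    ⊑-refl : ∀ {x} → x ⊑ x
    ⊑-refl {old x} = old⊑old ≼.refl
    ⊑-refl {new}   = new⊑new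

    ⊑-trans : ∀ {x y z} → x ⊑ y → y ⊑ z → x ⊑ z
    ⊑-trans (old⊑old x≼y) (old⊑old y≼z) = old⊑old (≼.trans x≼y y≼z)
    ⊑-trans (old⊑old x≼y) (old⊑new ¬Uy) = old⊑new (λ Ux → ¬Uy (U-up x≼y Ux))
    ⊑-trans (old⊑new ¬Ux) (new⊑old Uz) = old⊑old (∉U⇒≼ ¬Ux Uz)
    ⊑-trans (old⊑new ¬Ux) new⊑new       = old⊑new ¬Ux
    ⊑-trans (new⊑old Uy)  (old⊑old y≼z) = new⊑old (U-up y≼z Uy)
    ⊑-trans (new⊑old Uy)  (old⊑new ¬Uy) = ⊥-elim (¬Uy Uy)
    ⊑-trans new⊑new       y⊑z           = y⊑z

    ⊑-antisym : ∀ {x y} → x ⊑ y → y ⊑ x → x ≡ y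
    ⊑-antisym (old⊑old x≼y) (old⊑old y≼x) = cong old (≼.antisym x≼y y≼x)
    ⊑-antisym (old⊑new ¬Ux) (new⊑old Ux)  = ⊥-elim (¬Ux Ux)
    ⊑-antisym (new⊑old Uy)  (old⊑new ¬Uy) = ⊥-elim (¬Uy Uy)
    ⊑-antisym new⊑new       new⊑new       = refl

    ⊑-total : ∀ x y → x ⊑ y ⊎ y ⊑ x
    ⊑-total (old x) (old y) = Sum.map old⊑old old⊑old (≼.total x y)
    ⊑-total (old x) new with em {U x}
    ... | yes Ux = inj₂ (new⊑old Ux)
    ... | no ¬Ux = inj₁ (old⊑new ¬Ux)
    ⊑-total new (old y) with em {U y}
    ... | yes Uy = inj₁ (new⊑old Uy)
    ... | no ¬Uy = inj₂ (old⊑new ¬Uy)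
    ⊑-total new new = inj₁ new⊑new

    ⊑-isTotalOrder : IsTotalOrder _≡_ _⊑_
    ⊑-isTotalOrder = record
      { isPartialOrder = record
        { isPreorder = record
          { isEquivalence = isEquivalence
          ; reflexive     = λ { refl → ⊑-refl }
          ; trans         = ⊑-trans }
        ; antisym = ⊑-antisym }
      ; total = ⊑-total }

    Below : Formula → Set
    Below B = ∃ λ u → ¬ U u × M ⊩[ u ] B

    _⊩⁺_ : Point → _ → Set
    old x ⊩⁺ p = _⊩at_ M x p
    new   ⊩⁺ p = Below (var p)

    ⊩⁺-persistent : ∀ {x y} p → x ⊑ y → x ⊩⁺ p → y ⊩⁺ p
    ⊩⁺-persistent p (old⊑old x≼y)       xp             = persistent M p x≼y xp
    ⊩⁺-persistent p (old⊑new {x} ¬Ux)   xp             = x , ¬Ux , xp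
    ⊩⁺-persistent p (new⊑old Uy)        (u , ¬Uu , up) = persistent M p (∉U⇒≼ ¬Uu Uy) up
    ⊩⁺-persistent p new⊑new             np             = np

    M⁺ : Model
    M⁺ = record
      { World = Point ; _≼_ = _⊑_ ; isTotal = ⊑-isTotalOrder ; ρ = old (ρ M)
      ; ρ-min = λ { (old x) → old⊑old (ρ-min M x) ; new → old⊑new ρ∉U }
      ; _⊩at_ = _⊩⁺_ ; persistent = ⊩⁺-persistent }

    Below-∧ : ∀ B C → Below B → Below C → Below (B ∧̇ C)
    Below-∧ B C (u , ¬Uu , b) (v , ¬Uv , c) with ≼.total u v
    ... | inj₁ u≼v = v , ¬Uv , ⊩-mono M B u≼v b , c
    ... | inj₂ v≼u = u , ¬Uu , b , ⊩-mono M C v≼u c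

    Below-mp : ∀ B C → Below (B ⇒ C) → Below B → Below C
    Below-mp B C (u , ¬Uu , b⇒c) (v , ¬Uv , b) with ≼.total u v
    ... | inj₁ u≼v = v , ¬Uv , b⇒c v u≼v b
    ... | inj₂ v≼u = u , ¬Uu , b⇒c u ≼.refl (⊩-mono M B v≼u b)

    old-⊩⁻ : ∀ {x} B → M⁺ ⊩[ old x ] B → M ⊩[ x ] B
    old-⊩⁺ : ∀ {x} B → M ⊩[ x ] B → M⁺ ⊩[ old x ] B
    new-⊩⁻ : ∀ B → M⁺ ⊩[ new ] B → Below B
    new-⊩⁺ : ∀ B → Below B → M⁺ ⊩[ new ] B

    old-⊩⁻ (var p) xp = xp
    old-⊩⁻ ⊤̇       _  = tt
    old-⊩⁻ ⊥̇       ()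
    old-⊩⁻ (B ∧̇ C) bc = Product.map (old-⊩⁻ B) (old-⊩⁻ C) bc
    old-⊩⁻ (B ∨̇ C) bc = Sum.map (old-⊩⁻ B) (old-⊩⁻ C) bc
    old-⊩⁻ (B ⇒ C) b⇒c = λ y x≼y b → old-⊩⁻ C (b⇒c (old y) (old⊑old x≼y) (old-⊩⁺ B b))

    old-⊩⁺ (var p) xp = xp
    old-⊩⁺ ⊤̇       _  = tt
    old-⊩⁺ ⊥̇       ()
    old-⊩⁺ (B ∧̇ C) bc = Product.map (old-⊩⁺ B) (old-⊩⁺ C) bc
    old-⊩⁺ (B ∨̇ C) bc = Sum.map (old-⊩⁺ B) (old-⊩⁺ C) bc
    old-⊩⁺ (B ⇒ C) b⇒c (old y) (old⊑old x≼y) b = old-⊩⁺ C (b⇒c y x≼y (old-⊩⁻ B b))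
    old-⊩⁺ {x} (B ⇒ C) b⇒c new (old⊑new ¬Ux) b =
      new-⊩⁺ C (Below-mp B C (x , ¬Ux , b⇒c) (new-⊩⁻ B b))

    new-⊩⁻ (var p) np = np
    new-⊩⁻ ⊤̇       _  = ρ M , ρ∉U , tt
    new-⊩⁻ ⊥̇       ()
    new-⊩⁻ (B ∧̇ C) (b , c) = Below-∧ B C (new-⊩⁻ B b) (new-⊩⁻ C c)
    new-⊩⁻ (B ∨̇ C) (inj₁ b) = Product.map₂ (Product.map₂ inj₁) (new-⊩⁻ B b)
    new-⊩⁻ (B ∨̇ C) (inj₂ c) = Product.map₂ (Product.map₂ inj₂) (new-⊩⁻ C c)
    new-⊩⁻ (B ⇒ C) b⇒c with em {Below B}
    ... | yes (u , ¬Uu , b) with new-⊩⁻ C (b⇒c new new⊑new (new-⊩⁺ B (u , ¬Uu , b)))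
    ...   | v , ¬Uv , c = v , ¬Uv , λ β v≼β _ → ⊩-mono M C v≼β c
    -- If B holds nowhere below U, then B ⇒ C holds at ρ, since C holds in U.
    new-⊩⁻ (B ⇒ C) b⇒c | no ¬below = ρ M , ρ∉U , λ β _ b →
      old-⊩⁻ C (b⇒c (old β) (new⊑old (decidable-stable em λ ¬Uβ → ¬below (β , ¬Uβ , b)))
                    (old-⊩⁺ B b))

    new-⊩⁺ (var p) below = below
    new-⊩⁺ ⊤̇       _     = tt
    new-⊩⁺ ⊥̇       (_ , _ , ())
    new-⊩⁺ (B ∧̇ C) (u , ¬Uu , b , c) = new-⊩⁺ B (u , ¬Uu , b) , new-⊩⁺ C (u , ¬Uu , c)
    new-⊩⁺ (B ∨̇ C) (u , ¬Uu , inj₁ b) = inj₁ (new-⊩⁺ B (u , ¬Uu , b))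
    new-⊩⁺ (B ∨̇ C) (u , ¬Uu , inj₂ c) = inj₂ (new-⊩⁺ C (u , ¬Uu , c))
    new-⊩⁺ (B ⇒ C) below (old y) (new⊑old Uy) b with below
    ... | u , ¬Uu , b⇒c = old-⊩⁺ C (b⇒c y (∉U⇒≼ ¬Uu Uy) (old-⊩⁻ B b))
    new-⊩⁺ (B ⇒ C) below new new⊑new b = new-⊩⁺ C (Below-mp B C below (new-⊩⁻ B b))

    new-⊮ : ∀ B → (∀ {y} → M ⊩[ y ] B → U y) → ¬ M⁺ ⊩[ new ] B
    new-⊮ B B⊆U b with new-⊩⁻ B b
    ... | u , ¬Uu , ub = ¬Uu (B⊆U ub)

    new-forcedAfter : ∀ A → (∀ {y} → U y → M ⊩[ y ] A) → ForcedAfter M⁺ new A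
    new-forcedAfter A U⊆A (old y) new⋢y =
      old-⊩⁺ A (U⊆A (decidable-stable em λ ¬Uy → new⋢y (old⊑new ¬Uy)))
    new-forcedAfter A U⊆A new new⋢new = ⊥-elim (new⋢new new⊑new)

  refutedAtRoot⇒Fl-realizable : ∀ {M A} → ¬ M ⊩[ ρ M ] A → Realizable ((Fl ∙ A) ∷ [])
  refutedAtRoot⇒Fl-realizable {M} {A} ρ⊮A =
    M⁺ , new , (new-⊮ A (λ a → a) , new-forcedAfter A (λ a → a)) ∷ []
    where open Insertion M (M ⊩[_] A) (⊩-mono M A) ρ⊮A

  module FnTt-branches
    (M : Model) (α : World M) (S : List SF) (as : List (Formula × Formula)) (cs : List Formula)
    (imps : All (λ p → M ⊩[ α ] (proj₁ p ⇒ proj₂ p)) as) (S-real : M ⊨[ α ]* S)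
    (K : Formula) (K∈ : K ∈ map proj₁ as ++ cs) (K-refuted : RefutedAfter M α K)
    (K-latest : ∀ {β D} → D ∈ map proj₁ as ++ cs → M ⊩[ β ] D → M ⊩[ β ] K) where

    α⊮K : ¬ M ⊩[ α ] K
    α⊮K = refutedAfter⇒refuted M K K-refuted

    open Insertion M (M ⊩[_] K) (⊩-mono M K) (λ ρ⊩K → α⊮K (⊩-mono M K (ρ-min M α) ρ⊩K))

    new-⊮D : ∀ {D} → D ∈ map proj₁ as ++ cs → ¬ M⁺ ⊩[ new ] D
    new-⊮D {D} D∈ = new-⊮ D (K-latest D∈)

    new-⊩-at-α : ∀ A → M ⊩[ α ] A → M⁺ ⊩[ new ] A
    new-⊩-at-α A a = new-⊩⁺ A (α , α⊮K , a)

    new-⊩-after-α : ∀ A → ForcedAfter M α A → M⁺ ⊩[ new ] A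
    new-⊩-after-α A after =
      let β , α≺β , β⊮K = K-refuted in new-⊩⁺ A (β , β⊮K , after β α≺β)

    hats-real : ∀ {ps} → ps ⊆ as → M⁺ ⊨[ new ]* map hatOf ps
    hats-real ps⊆as = map⁺ (All.tabulate λ {p} p∈ →
      new-⊩-at-α (proj₁ p ⇒ proj₂ p) (All.lookup imps (ps⊆as p∈)) ,
      new-⊮D (∈-++⁺ˡ (∈-map⁺ proj₁ (ps⊆as p∈))))

    Fs-real : ∀ {qs} → qs ⊆ cs → M⁺ ⊨[ new ]* map (F ∙_) qs
    Fs-real qs⊆cs = map⁺ (All.tabulate λ q∈ → new-⊮D (∈-++⁺ʳ (map proj₁ as) (qs⊆cs q∈)))

    Sc-real : M⁺ ⊨[ new ]* Sc S
    Sc-real = ⊨-Sc new-⊩-at-α new-⊩-after-α S-real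

    Fl-real : ∀ {D} → D ∈ map proj₁ as ++ cs → K ≡ D → M⁺ ⊨[ new ] (Fl ∙ D)
    Fl-real {D} D∈ K≡D = new-⊮D D∈ , new-forcedAfter D (subst (M ⊩[ _ ]_) K≡D)

    imp-branch : ∀ {p} → p ∈ as → K ≡ proj₁ p →
                 ∃ λ j → M⁺ ⊨[ new ]* (Sc S ++ Vimp as j ++ map (F ∙_) cs)
    imp-branch p∈ K≡A = j , ++⁺ Sc-real (++⁺ (++⁺ (hats-real (removeAt-⊆ as j)) (fl ∷ tn ∷ []))
                                            (Fs-real (λ c∈ → c∈)))
      where
      j   = index p∈
      q∈  = subst (_∈ as) (lookup-index p∈) p∈
      K≡q = trans K≡A (cong proj₁ (lookup-index p∈))
      fl : M⁺ ⊨[ new ] (Fl ∙ proj₁ (lookup as j))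
      fl = Fl-real (∈-++⁺ˡ (∈-map⁺ proj₁ q∈)) K≡q
      tn : M⁺ ⊨[ new ] (Tn ∙ proj₂ (lookup as j))
      tn = new-forcedAfter (proj₂ (lookup as j)) λ k →
        All.lookup imps q∈ _ (∉upset⇒≼ M (M ⊩[_] K) (⊩-mono M K) α⊮K k) (subst (M ⊩[ _ ]_) K≡q k)

    neg-branch : K ∈ cs → ∃ λ j → M⁺ ⊨[ new ]* (Sc S ++ map hatOf as ++ Vneg cs j)
    neg-branch K∈cs = j , ++⁺ Sc-real (++⁺ (hats-real (λ p∈ → p∈))
                                          (++⁺ (Fs-real (removeAt-⊆ cs j)) (fl ∷ [])))
      where
      j  = index K∈cs
      fl : M⁺ ⊨[ new ] (Fl ∙ lookup cs j)
      fl = Fl-real (∈-++⁺ʳ (map proj₁ as) (subst (_∈ cs) (lookup-index K∈cs) K∈cs))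
                   (lookup-index K∈cs)

    branch : (∃ λ j → Realizable (Sc S ++ Vimp as j ++ map (F ∙_) cs)) ⊎
             (∃ λ j → Realizable (Sc S ++ map hatOf as ++ Vneg cs j))
    branch with ∈-++⁻ (map proj₁ as) K∈
    ... | inj₂ K∈cs = inj₂ (Product.map₂ (λ R → M⁺ , new , R) (neg-branch K∈cs))
    ... | inj₁ K∈A with ∈-map⁻ proj₁ K∈A
    ...   | p , p∈ , K≡A = inj₁ (Product.map₂ (λ R → M⁺ , new , R) (imp-branch p∈ K≡A))

  length-heads : ∀ (as : List (Formula × Formula)) cs →
                 length (map proj₁ as ++ cs) ≡ length as + length cs
  length-heads as cs = trans (length-++ (map proj₁ as)) (cong (_+ length cs) (length-map proj₁ as))

  FnTt-realizable : ∀ {M α S} as cs → 1 ≤ length as + length cs →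
    M ⊨[ α ]* (map tildeOf as ++ map (Fn ∙_) cs) → M ⊨[ α ]* S →
    (∃ λ j → Realizable (Sc S ++ Vimp as j ++ map (F ∙_) cs)) ⊎
    (∃ λ j → Realizable (Sc S ++ map hatOf as ++ Vneg cs j))
  FnTt-realizable {M} {α} {S} as cs nonempty D-real S-real
    with latest M (map proj₁ as ++ cs) (subst (1 ≤_) (sym (length-heads as cs)) nonempty)
  ... | K , K∈ , K-latest =
    FnTt-branches.branch M α S as cs (All.map proj₁ Tt-real) S-real K K∈
                         (All.lookup refuted K∈) K-latest
    where
    Tt-real = map⁻ (proj₁ (++⁻ (map tildeOf as) D-real))
    refuted : All (RefutedAfter M α) (map proj₁ as ++ cs)
    refuted = ++⁺ (map⁺ (All.map proj₂ Tt-real)) (map⁻ (proj₂ (++⁻ (map tildeOf as) D-real)))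

  closed⇒unrealizable : ∀ {Γ} → Closed Γ → ∀ M α → ¬ M ⊨[ α ]* Γ
  closed⇒unrealizable (leaf inconsistent) M α R = inconsistent⇒unrealizable inconsistent R
  closed⇒unrealizable (T∧ eq _ k) M α R with All-uncons-≋ eq R
  ... | (a , b) , rs = closed⇒unrealizable k M α (a ∷ b ∷ rs)
  closed⇒unrealizable (Fl∧ {A = A} {B} eq _ k₁ k₂) M α R with All-uncons-≋ eq R
  ... | r , rs with Fl∧-inversion M A B r
  ...   | inj₁ (x , y) = closed⇒unrealizable k₁ M α (x ∷ y ∷ rs)
  ...   | inj₂ (x , y) = closed⇒unrealizable k₂ M α (x ∷ y ∷ rs)
  closed⇒unrealizable (T∨ eq _ k₁ k₂) M α R with All-uncons-≋ eq R
  ... | inj₁ a , rs = closed⇒unrealizable k₁ M α (a ∷ rs)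
  ... | inj₂ b , rs = closed⇒unrealizable k₂ M α (b ∷ rs)
  closed⇒unrealizable (Fl∨ {A = A} {B} eq _ k₁ k₂) M α R with All-uncons-≋ eq R
  ... | r , rs with Fl∨-inversion M A B r
  ...   | inj₁ (x , y) = closed⇒unrealizable k₁ M α (x ∷ y ∷ rs)
  ...   | inj₂ (x , y) = closed⇒unrealizable k₂ M α (x ∷ y ∷ rs)
  closed⇒unrealizable (T⇒ {A = A} {B} eq _ k₁ k₂ k₃) M α R with All-uncons-≋ eq R
  ... | r , rs with T⇒-inversion M A B r
  ...   | inj₁ x              = closed⇒unrealizable k₁ M α (x ∷ rs)
  ...   | inj₂ (inj₁ (x , y)) = closed⇒unrealizable k₂ M α (x ∷ y ∷ rs)
  ...   | inj₂ (inj₂ x)       = closed⇒unrealizable k₃ M α (x ∷ rs)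
  closed⇒unrealizable (Fl⇒ {A = A} {B} eq _ k) M α R with All-uncons-≋ eq R
  ... | r , rs with Fl⇒-inversion M A B r
  ...   | x , y = closed⇒unrealizable k M α (x ∷ y ∷ rs)
  closed⇒unrealizable (F-decide {A = A} eq _ k₁ k₂) M α R with All-uncons-≋ eq R
  ... | r , rs with F-inversion M A r
  ...   | inj₁ x = closed⇒unrealizable k₁ M α (x ∷ rs)
  ...   | inj₂ x = closed⇒unrealizable k₂ M α (x ∷ rs)
  closed⇒unrealizable (Th-decide {A = A} {B} eq _ k₁ k₂) M α R with All-uncons-≋ eq R
  ... | r , rs with Th-inversion M A B r
  ...   | inj₁ (x , y) = closed⇒unrealizable k₁ M α (x ∷ y ∷ rs)
  ...   | inj₂ x       = closed⇒unrealizable k₂ M α (x ∷ rs)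
  closed⇒unrealizable (FnTt as cs nonempty eq _ _ k₁ k₂) M α R
    with anti-mono (λ {x} → proj₂ (eq x)) R
  ... | R′ with ++⁻ (map tildeOf as ++ map (Fn ∙_) cs) R′
  ...   | D-real , S-real with FnTt-realizable as cs nonempty D-real S-real
  ...     | inj₁ (j , _ , _ , R″) = closed⇒unrealizable (k₁ j) _ _ R″
  ...     | inj₂ (j , _ , _ , R″) = closed⇒unrealizable (k₂ j) _ _ R″

  closed-Fl⇒valid : (A : Formula) → Closed ((Fl ∙ A) ∷ []) → Valid A
  closed-Fl⇒valid A closed M with em {M ⊩[ ρ M ] A}
  ... | yes ρ⊩A = ρ⊩A
  ... | no ρ⊮A with refutedAtRoot⇒Fl-realizable ρ⊮A
  ...   | _ , _ , R = ⊥-elim (closed⇒unrealizable closed _ _ R)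

theorem1 : ExcludedMiddle 0ℓ → (A : Formula) → Closed ((Fl ∙ A) ∷ []) → Valid A
theorem1 em = Classical.closed-Fl⇒valid em
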